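{- For any positive integers $q$ and $k$ there exists a constant $f(q,k)$ such that the following holds. Let $D=(V,A)$ be a Steiner rooted $k$-arc-connected directed graph with root $r$ and a single terminal $s$, and let $\mathcal{C}$ be a family of pairwise vertex-disjoint $s$-essential directed cycles of $D$ with $|\mathcal{C}|\ge f(q,k)$. Then there exist $C_1,\ldots,C_q\in\mathcal{C}$ such that $(C_1,\ldots,C_q)$ is an $s$-ordered sequence of directed cycles.
   Context: $D$ is Steiner rooted $k$-arc-connected with root $r$ and terminal set $S\subseteq V\setminus\{r\}$ if for every $s\in S$ there are $k$ pairwise arc-disjoint directed $r$-$s$ paths. For $s\in S$, an $s$-cut is a set $U\subseteq V$ with $r\in U$, $s\notin U$; it is tight if exactly $k$ arcs leave $U$ (have tail in $U$ and head outside $U$). A set $U$ properly intersects a directed cycle $C$ if $V(C)\cap U\neq\emptyset$ and $V(C)\setminus U\neq\emptyset$. A directed cycle $C$ is $s$-essential if some tight $s$-cut properly intersects $C$. A sequence of directed cycles $(C_1,\ldots,C_q)$ is $s$-ordered if there exist tight $s$-cuts $U_1,\ldots,U_q$ such that $V(C_i)\subseteq U_j$ for all $i<j$, $V(C_i)\cap U_j=\emptyset$ for all $i>j$, and $U_i$ properly intersects $C_i$ for every $i$. -}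

module Defs where

open import Data.Nat using (ℕ; suc; _≤_)
open import Data.Fin using (Fin)
open import Data.Bool using (Bool; true; false; _∧_; not; T)
open import Data.List using (List; []; _∷_; _++_; map; filter; length; allFin)
open import Data.List.Membership.Propositional using (_∈_)
open import Data.List.Relation.Unary.Unique.Propositional using (Unique)
open import Data.Product using (Σ; _×_; ∃)
open import Relation.Nullary using (¬_)
open import Relation.Binary.PropositionalEquality using (_≡_; _≢_)
open import Data.Bool.Properties using (T?)

record Digraph : Set where
  field
    n    : ℕ
    m    : ℕ
    tail : Fin m → Fin n
    head : Fin m → Fin n

module _ (D : Digraph) where
  open Digraph D

  Vertex : Set
  Vertex = Fin n

  Arc : Set
  Arc = Fin m

  data Walk : Vertex → Vertex → Set where
    []  : ∀ {u} → Walk u u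
    _∷_ : ∀ {v} (a : Arc) → Walk (head a) v → Walk (tail a) v

  walkArcs : ∀ {u v} → Walk u v → List Arc
  walkArcs []      = []
  walkArcs (a ∷ w) = a ∷ walkArcs w

  walkVertices : ∀ {u v} → Walk u v → List Vertex
  walkVertices {u} []      = u ∷ []
  walkVertices (a ∷ w) = tail a ∷ walkVertices w

  record Path (u v : Vertex) : Set where
    field
      walk   : Walk u v
      simple : Unique (walkVertices walk)

  ArcDisjoint : ∀ {u v u' v'} → Path u v → Path u' v' → Set
  ArcDisjoint p p' = ∀ a → a ∈ walkArcs (Path.walk p) → ¬ (a ∈ walkArcs (Path.walk p'))

  SteinerRootedArcConnected : ℕ → Vertex → (Vertex → Set) → Set
  SteinerRootedArcConnected k r S =
    (∀ s → S s → s ≢ r) ×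
    (∀ s → S s → Σ (Fin k → Path r s) λ P → ∀ i j → i ≢ j → ArcDisjoint (P i) (P j))

  record Cycle : Set where
    field
      base     : Vertex
      walk     : Walk base base
      nonempty : walkArcs walk ≢ []
      simple   : Unique (map tail (walkArcs walk))

  _∈V_ : Vertex → Cycle → Set
  v ∈V C = v ∈ map tail (walkArcs (Cycle.walk C))

  VSet : Set
  VSet = Vertex → Bool

  outDegree : VSet → ℕ
  outDegree U = length (filter (λ a → T? (U (tail a) ∧ not (U (head a)))) (allFin m))

  IsCut : Vertex → Vertex → VSet → Set
  IsCut r s U = T (U r) × T (not (U s))

  TightCut : ℕ → Vertex → Vertex → VSet → Set
  TightCut k r s U = IsCut r s U × outDegree U ≡ k

  ProperlyIntersects : VSet → Cycle → Set
  ProperlyIntersects U C = (∃ λ v → v ∈V C × T (U v)) × (∃ λ v → v ∈V C × T (not (U v)))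

  Essential : ℕ → Vertex → Vertex → Cycle → Set
  Essential k r s C = ∃ λ U → TightCut k r s U × ProperlyIntersects U C

  VertexDisjoint : Cycle → Cycle → Set
  VertexDisjoint C C' = ∀ v → v ∈V C → ¬ (v ∈V C')

  Ordered : ℕ → Vertex → Vertex → (q : ℕ) → (Fin q → Cycle) → Set
  Ordered k r s q C = Σ (Fin q → VSet) λ U →
    (∀ i → TightCut k r s (U i)) ×
    (∀ i j → i Data.Fin.< j → ∀ v → v ∈V C i → T (U j v)) ×
    (∀ i j → j Data.Fin.< i → ∀ v → v ∈V C i → T (not (U j v))) ×
    (∀ i → ProperlyIntersects (U i) (C i))

{-# OPTIONS --safe #-}
-- Out-degree is submodular and every s-cut has out-degree at least k (each of the k arc-disjoint
-- r-s paths leaves it), so tight cuts are closed under ∩ and ∪. A properly intersected cycle contains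
-- an arc leaving the cut, so a tight cut properly intersects at most k of the disjoint cycles.
--
-- Start with a tight cut V i crossing each cycle i and repeatedly record a cycle j with its cut W = V j:
-- apart from at most k of them, the remaining cycles lie inside or outside W; keep the larger group and
-- replace each of their cuts V x by V x ∩ W (resp. V x ∪ W), which is still tight and still crosses its
-- cycle. After L rounds, starting from chainBound k L cycles, every recorded cycle and cut lies on the
-- recorded side of all earlier cuts. Half of the entries share their side, and greedily dropping the at
-- most k cycles crossed by each kept cut leaves q cycles that the recorded cuts put in s-order.
module Submission where

open import Defs
open import Data.Nat using (ℕ; zero; suc; _+_; _*_; _≤_; _<_; _>_; z≤n; s≤s; _≤?_)
open import Data.Nat.Base using (>-nonZero)
open import Data.Nat.Properties hiding (_≟_)
open import Data.Fin as Fin using (Fin; zero; suc; inject≤; _≟_)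
open import Data.Fin.Properties using (injective⇒≤; toℕ-inject≤)
open import Data.Bool as Bool using (Bool; true; false; _∧_; _∨_; not; T)
open import Data.Bool.Properties using (T?; T-∧; T-∨)
open import Data.Unit using (tt)
open import Data.Empty using (⊥-elim)
open import Data.List using (List; []; _∷_; map; filter; length; allFin; lookup; reverse; _ʳ++_)
open import Data.List.Properties using (length-filter; length-reverse; length-tabulate)
open import Data.List.Membership.Propositional using (_∈_; find; lose)
open import Data.List.Membership.Propositional.Properties using (∈-allFin; ∈-filter⁺; ∈-lookup; ∈-map⁺)
open import Data.List.Relation.Unary.Any using (Any; here; there; index; any?)
open import Data.List.Relation.Unary.Any.Properties using (lookup-index)
open import Data.List.Relation.Unary.All as All using (All; []; _∷_)
open import Data.List.Relation.Unary.All.Properties as Allₚ using (all-filter; tabulate⁺; ¬All⇒Any¬)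
open import Data.List.Relation.Unary.AllPairs as AllPairs using (AllPairs; []; _∷_)
import Data.List.Relation.Unary.AllPairs.Properties as AllPairsₚ
open import Data.List.Relation.Unary.Unique.Propositional using (Unique)
open import Data.List.Relation.Unary.Unique.Propositional.Properties using (allFin⁺)
import Data.List.Relation.Binary.Sublist.Propositional as Sublist
open import Data.List.Relation.Binary.Sublist.Propositional.Properties using (filter-⊆; All-resp-⊆)
open import Data.Product using (Σ; ∃; _×_; _,_; proj₁; proj₂; uncurry)
open import Data.Sum using (_⊎_; inj₁; inj₂; [_,_]′)
open import Function using (_∘_; _on_; flip; id; case_of_; Equivalence)
open import Relation.Nullary using (¬_; Dec; yes; no; ¬?)
open import Relation.Nullary.Decidable as Dec using (toSum; _×-dec_)
open import Relation.Unary using (Decidable)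
open import Relation.Binary.PropositionalEquality
  using (_≡_; _≢_; refl; sym; cong; cong₂; subst; subst₂; module ≡-Reasoning)
open import Algebra.Properties.CommutativeSemigroup +-commutativeSemigroup using (interchange)

private
  variable
    A : Set
    a b : Bool

¬T⇒T-not : ¬ T a → T (not a)
¬T⇒T-not {false} _ = tt
¬T⇒T-not {true} ¬t = ¬t tt

T-not⇒¬T : T (not a) → ¬ T a
T-not⇒¬T {false} _ ()

T-not-∧ˡ : T (not a) → T (not (a ∧ b))
T-not-∧ˡ na = ¬T⇒T-not (T-not⇒¬T na ∘ proj₁ ∘ Equivalence.to T-∧)

T-not-∨ : T (not a) → T (not b) → T (not (a ∨ b))
T-not-∨ na nb = ¬T⇒T-not ([ T-not⇒¬T na , T-not⇒¬T nb ]′ ∘ Equivalence.to T-∨)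

T-not-contra : (T a → T b) → T (not b) → T (not a)
T-not-contra a⇒b nb = ¬T⇒T-not (T-not⇒¬T nb ∘ a⇒b)

indicator : Bool → ℕ
indicator true = 1
indicator false = 0

count : (A → Bool) → List A → ℕ
count f xs = length (filter (T? ∘ f) xs)

count-∷ : ∀ (f : A → Bool) x xs → count f (x ∷ xs) ≡ indicator (f x) + count f xs
count-∷ f x xs with f x
... | true = refl
... | false = refl

module _ (f g f′ g′ : A → Bool)
  (pointwise : ∀ x → indicator (f x) + indicator (g x) ≤ indicator (f′ x) + indicator (g′ x))
  where

  count-+-mono-≤ : ∀ xs → count f xs + count g xs ≤ count f′ xs + count g′ xs
  count-+-mono-≤ [] = z≤n
  count-+-mono-≤ (x ∷ xs) = begin
    count f (x ∷ xs) + count g (x ∷ xs)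
      ≡⟨ cong₂ _+_ (count-∷ f x xs) (count-∷ g x xs) ⟩
    (indicator (f x) + count f xs) + (indicator (g x) + count g xs)
      ≡⟨ interchange (indicator (f x)) (count f xs) (indicator (g x)) (count g xs) ⟩
    (indicator (f x) + indicator (g x)) + (count f xs + count g xs)
      ≤⟨ +-mono-≤ (pointwise x) (count-+-mono-≤ xs) ⟩
    (indicator (f′ x) + indicator (g′ x)) + (count f′ xs + count g′ xs)
      ≡⟨ interchange (indicator (f′ x)) (indicator (g′ x)) (count f′ xs) (count g′ xs) ⟩
    (indicator (f′ x) + count f′ xs) + (indicator (g′ x) + count g′ xs)
      ≡⟨ sym (cong₂ _+_ (count-∷ f′ x xs) (count-∷ g′ x xs)) ⟩
    count f′ (x ∷ xs) + count g′ (x ∷ xs) ∎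
    where open ≤-Reasoning

length-filter-⊎ : ∀ {P Q : A → Set} (P? : Decidable P) (Q? : Decidable Q) {xs} →
  All (λ x → P x ⊎ Q x) xs → length xs ≤ length (filter P? xs) + length (filter Q? xs)
length-filter-⊎ P? Q? [] = z≤n
length-filter-⊎ P? Q? {x ∷ xs} (P⊎Q ∷ rest) with P? x | Q? x | length-filter-⊎ P? Q? rest
... | yes _ | yes _ | ih = s≤s (≤-trans ih (+-monoʳ-≤ _ (n≤1+n _)))
... | yes _ | no _  | ih = s≤s ih
... | no _  | yes _ | ih = ≤-trans (s≤s ih) (≤-reflexive (sym (+-suc _ _)))
... | no ¬p | no ¬q | _  = ⊥-elim ([ ¬p , ¬q ]′ P⊎Q)

lookup-injective : ∀ {B : Set} {f : A → B} {xs} → AllPairs (_≢_ on f) xs →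
  ∀ i j → f (lookup xs i) ≡ f (lookup xs j) → i ≡ j
lookup-injective (_ ∷ _) zero zero _ = refl
lookup-injective (x≢ ∷ _) zero (suc j) eq = ⊥-elim (All.lookup x≢ (∈-lookup j) eq)
lookup-injective (x≢ ∷ _) (suc i) zero eq = ⊥-elim (All.lookup x≢ (∈-lookup i) (sym eq))
lookup-injective (_ ∷ distinct) (suc i) (suc j) eq = cong suc (lookup-injective distinct i j eq)

injective⇒≤length : ∀ {t} (xs : List A) (f : Fin t → A) → (∀ i → f i ∈ xs) →
  (∀ {i j} → f i ≡ f j → i ≡ j) → t ≤ length xs
injective⇒≤length xs f f∈xs f-injective = injective⇒≤ λ {i} {j} eq → f-injective (begin
  f i                           ≡⟨ lookup-index (f∈xs i) ⟩
  lookup xs (index (f∈xs i))    ≡⟨ cong (lookup xs) eq ⟩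
  lookup xs (index (f∈xs j))    ≡⟨ sym (lookup-index (f∈xs j)) ⟩
  f j                           ∎)
  where open ≡-Reasoning

AllPairs-lookup : ∀ {R : A → A → Set} {xs} → AllPairs R xs →
  ∀ {i j : Fin (length xs)} → i Fin.< j → R (lookup xs i) (lookup xs j)
AllPairs-lookup (Rx ∷ _) {zero} {suc j} _ = All.lookup Rx (∈-lookup j)
AllPairs-lookup (_ ∷ Rxs) {suc i} {suc j} (s≤s i<j) = AllPairs-lookup Rxs i<j

AllPairs-ʳ++ : ∀ {R : A → A → Set} {xs ys} → AllPairs (flip R) xs → AllPairs R ys →
  All (λ x → All (R x) ys) xs → AllPairs R (xs ʳ++ ys)
AllPairs-ʳ++ [] Rys _ = Rys
AllPairs-ʳ++ (Rx ∷ Rxs) Rys (x-ys ∷ xs-ys) =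
  AllPairs-ʳ++ Rxs (x-ys ∷ Rys) (All.zipWith (uncurry _∷_) (Rx , xs-ys))

AllPairs-reverse : ∀ {R : A → A → Set} {xs} → AllPairs (flip R) xs → AllPairs R (reverse xs)
AllPairs-reverse Rxs = AllPairs-ʳ++ Rxs [] (All.universal (λ _ → []) _)

AllPairs-×-All : ∀ {R : A → A → Set} {P : A → Set} {xs} → AllPairs R xs → All P xs →
  AllPairs (λ x y → R x y × P y) xs
AllPairs-×-All [] [] = []
AllPairs-×-All (Rx ∷ Rxs) (_ ∷ Pxs) = All.zip (Rx , Pxs) ∷ AllPairs-×-All Rxs Pxs

≤-double⇒≡ : ∀ {m n k} → m + n ≤ k + k → k ≤ m → k ≤ n → m ≡ k × n ≡ k
≤-double⇒≡ {m} {n} {k} m+n≤ k≤m k≤n =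
  ≤-antisym (+-cancelʳ-≤ k m k (≤-trans (+-monoʳ-≤ m k≤n) m+n≤)) k≤m ,
  ≤-antisym (+-cancelˡ-≤ k n k (≤-trans (+-monoˡ-≤ n k≤m) m+n≤)) k≤n

half≤either : ∀ {B m n} → B + B ≤ m + n → B ≤ m ⊎ B ≤ n
half≤either {B} {m} {n} total with B ≤? m
... | yes B≤m = inj₁ B≤m
... | no B≰m = inj₂ (≮⇒≥ λ n<B → <⇒≱ (+-mono-< (≰⇒> B≰m) n<B) total)

true-or-false : ∀ b → b ≡ true ⊎ b ≡ false
true-or-false true = inj₁ refl
true-or-false false = inj₂ refl

-- One cycle is recorded, its cut crosses at most k of the others, and one side keeps half of the rest.
chainBound : ℕ → ℕ → ℕ
chainBound k zero = zero
chainBound k (suc L) = suc (chainBound k L + chainBound k L + k)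

module _ (D : Digraph) where
  open Digraph D

  _∩_ : VSet D → VSet D → VSet D
  (X ∩ Y) v = X v ∧ Y v

  _∪_ : VSet D → VSet D → VSet D
  (X ∪ Y) v = X v ∨ Y v

  _⊆_ : VSet D → VSet D → Set
  X ⊆ Y = ∀ {v} → T (X v) → T (Y v)

  leaves : VSet D → Arc D → Bool
  leaves U a = U (tail a) ∧ not (U (head a))

  walk-exits : ∀ U {u v} (w : Walk D u v) → T (U u) → T (not (U v)) →
    Any (T ∘ leaves U) (walkArcs D w)
  walk-exits U [] u∈U u∉U = ⊥-elim (T-not⇒¬T u∉U u∈U)
  walk-exits U (a ∷ w) u∈U v∉U with T? (U (head a))
  ... | yes h∈U = there (walk-exits U w h∈U v∉U)
  ... | no h∉U = here (Equivalence.from T-∧ (u∈U , ¬T⇒T-not h∉U))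

  walk-exits-before : ∀ U {u v x} (w : Walk D u v) → T (U u) →
    x ∈ map tail (walkArcs D w) → T (not (U x)) → Any (T ∘ leaves U) (walkArcs D w)
  walk-exits-before U (a ∷ w) u∈U (here refl) x∉U = ⊥-elim (T-not⇒¬T x∉U u∈U)
  walk-exits-before U (a ∷ w) u∈U (there x∈w) x∉U with T? (U (head a))
  ... | yes h∈U = there (walk-exits-before U w h∈U x∈w x∉U)
  ... | no h∉U = here (Equivalence.from T-∧ (u∈U , ¬T⇒T-not h∉U))

  walk-exits-after : ∀ U {u v x} (w : Walk D u v) → x ∈ map tail (walkArcs D w) → T (U x) →
    T (not (U v)) → Any (T ∘ leaves U) (walkArcs D w)
  walk-exits-after U (a ∷ w) (here refl) x∈U v∉U = walk-exits U (a ∷ w) x∈U v∉U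
  walk-exits-after U (a ∷ w) (there x∈w) x∈U v∉U = there (walk-exits-after U w x∈w x∈U v∉U)

  cycle-exits : ∀ {U C} → ProperlyIntersects D U C → Any (T ∘ leaves U) (walkArcs D (Cycle.walk C))
  cycle-exits {U} {C} ((x , x∈C , x∈U) , (y , y∈C , y∉U)) with T? (U (Cycle.base C))
  ... | yes base∈U = walk-exits-before U (Cycle.walk C) base∈U y∈C y∉U
  ... | no base∉U = walk-exits-after U (Cycle.walk C) x∈C x∈U (¬T⇒T-not base∉U)

  disjoint-exits⇒≤outDegree : ∀ {t} U (as : Fin t → List (Arc D)) →
    (∀ i → Any (T ∘ leaves U) (as i)) → (∀ i j → i ≢ j → ∀ a → a ∈ as i → ¬ a ∈ as j) →
    t ≤ outDegree D U
  disjoint-exits⇒≤outDegree {t} U as exits disjoint =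
    injective⇒≤length (filter (T? ∘ leaves U) (allFin m)) exit exit-leaves exit-injective
    where
    exit : Fin t → Arc D
    exit i = proj₁ (find (exits i))

    exit∈ : ∀ i → exit i ∈ as i
    exit∈ i = proj₁ (proj₂ (find (exits i)))

    exit-leaves : ∀ i → exit i ∈ filter (T? ∘ leaves U) (allFin m)
    exit-leaves i = ∈-filter⁺ (T? ∘ leaves U) (∈-allFin _) (proj₂ (proj₂ (find (exits i))))

    exit-injective : ∀ {i j} → exit i ≡ exit j → i ≡ j
    exit-injective {i} {j} eq with i ≟ j
    ... | yes i≡j = i≡j
    ... | no i≢j = ⊥-elim (disjoint i j i≢j (exit i) (exit∈ i) (subst (_∈ as j) (sym eq) (exit∈ j)))

  outDegree≥k : ∀ {k r S s U} → SteinerRootedArcConnected D k r S → S s → IsCut D r s U →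
    k ≤ outDegree D U
  outDegree≥k {U = U} (_ , paths) s∈S (r∈U , s∉U) with paths _ s∈S
  ... | P , arc-disjoint = disjoint-exits⇒≤outDegree U (λ i → walkArcs D (Path.walk (P i)))
        (λ i → walk-exits U (Path.walk (P i)) r∈U s∉U) arc-disjoint

  leaves-submodular : ∀ xt xh yt yh →
    indicator ((xt ∧ yt) ∧ not (xh ∧ yh)) + indicator ((xt ∨ yt) ∧ not (xh ∨ yh))
      ≤ indicator (xt ∧ not xh) + indicator (yt ∧ not yh)
  leaves-submodular false _     false _     = z≤n
  leaves-submodular false true  true  _     = z≤n
  leaves-submodular false false true  _     = ≤-refl
  leaves-submodular true  true  false _     = z≤n
  leaves-submodular true  false false true  = z≤n
  leaves-submodular true  false false false = ≤-refl
  leaves-submodular true  true  true  true  = z≤n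
  leaves-submodular true  true  true  false = ≤-refl
  leaves-submodular true  false true  true  = ≤-refl
  leaves-submodular true  false true  false = ≤-refl

  outDegree-submodular : ∀ X Y →
    outDegree D (X ∩ Y) + outDegree D (X ∪ Y) ≤ outDegree D X + outDegree D Y
  outDegree-submodular X Y = count-+-mono-≤ (leaves (X ∩ Y)) (leaves (X ∪ Y)) (leaves X) (leaves Y)
    (λ a → leaves-submodular (X (tail a)) (X (head a)) (Y (tail a)) (Y (head a))) (allFin m)

  tight-∩-∪ : ∀ {k r S s X Y} → SteinerRootedArcConnected D k r S → S s →
    TightCut D k r s X → TightCut D k r s Y → TightCut D k r s (X ∩ Y) × TightCut D k r s (X ∪ Y)
  tight-∩-∪ {k} {r} {s = s} {X} {Y} conn s∈S ((r∈X , s∉X) , X-tight) ((r∈Y , s∉Y) , Y-tight) =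
    (cut-∩ , proj₁ both-tight) , (cut-∪ , proj₂ both-tight)
    where
    cut-∩ : IsCut D r s (X ∩ Y)
    cut-∩ = Equivalence.from T-∧ (r∈X , r∈Y) , T-not-∧ˡ s∉X

    cut-∪ : IsCut D r s (X ∪ Y)
    cut-∪ = Equivalence.from T-∨ (inj₁ r∈X) , T-not-∨ s∉X s∉Y

    both-tight : outDegree D (X ∩ Y) ≡ k × outDegree D (X ∪ Y) ≡ k
    both-tight = ≤-double⇒≡
      (subst₂ (λ dX dY → _ ≤ dX + dY) X-tight Y-tight (outDegree-submodular X Y))
      (outDegree≥k conn s∈S cut-∩) (outDegree≥k conn s∈S cut-∪)

  vertices : Cycle D → List (Vertex D)
  vertices C = map tail (walkArcs D (Cycle.walk C))

  Inside : VSet D → Cycle D → Set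
  Inside U C = All (λ v → T (U v)) (vertices C)

  Outside : VSet D → Cycle D → Set
  Outside U C = All (λ v → T (not (U v))) (vertices C)

  Side : Bool → VSet D → Cycle D → Set
  Side true = Inside
  Side false = Outside

  side? : ∀ d U C → Dec (Side d U C)
  side? true U C = All.all? (T? ∘ U) (vertices C)
  side? false U C = All.all? (T? ∘ not ∘ U) (vertices C)

  crosses? : ∀ U C → Dec (ProperlyIntersects D U C)
  crosses? U C = has-vertex (T? ∘ U) ×-dec has-vertex (T? ∘ not ∘ U)
    where
    has-vertex : ∀ {P : Vertex D → Set} → Decidable P → Dec (∃ λ v → v ∈ vertices C × P v)
    has-vertex P? = Dec.map′ find (λ (_ , v∈C , Pv) → lose v∈C Pv) (any? P? (vertices C))

  inside-of-¬crosses : ∀ {U C} → ¬ ProperlyIntersects D U C →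
    (∃ λ v → v ∈ vertices C × T (U v)) → Inside U C
  inside-of-¬crosses {U} ¬crosses some-in = All.tabulate λ {v} v∈C → case T? (U v) of λ where
    (yes v∈U) → v∈U
    (no v∉U) → ⊥-elim (¬crosses (some-in , v , v∈C , ¬T⇒T-not v∉U))

  outside-of-¬crosses : ∀ {U C} → ¬ ProperlyIntersects D U C →
    (∃ λ v → v ∈ vertices C × T (not (U v))) → Outside U C
  outside-of-¬crosses {U} ¬crosses some-out = All.tabulate λ {v} v∈C → case T? (U v) of λ where
    (yes v∈U) → ⊥-elim (¬crosses ((v , v∈C , v∈U) , some-out))
    (no v∉U) → ¬T⇒T-not v∉U

  inside-or-outside : ∀ {U C} → ¬ ProperlyIntersects D U C → Side true U C ⊎ Side false U C
  inside-or-outside {U} {C} ¬crosses with side? true U C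
  ... | yes inside = inj₁ inside
  ... | no ¬inside with find (¬All⇒Any¬ (T? ∘ U) (vertices C) ¬inside)
  ...   | v , v∈C , v∉U = inj₂ (outside-of-¬crosses {U} {C} ¬crosses (v , v∈C , ¬T⇒T-not v∉U))

  crosses⇒¬side : ∀ d {U C} → ProperlyIntersects D U C → ¬ Side d U C
  crosses⇒¬side true (_ , (v , v∈C , v∉U)) inside = T-not⇒¬T v∉U (All.lookup inside v∈C)
  crosses⇒¬side false ((v , v∈C , v∈U) , _) outside = T-not⇒¬T (All.lookup outside v∈C) v∈U

  crossings≤outDegree : ∀ {t} U (Cs : Fin t → Cycle D) →
    (∀ i j → i ≢ j → VertexDisjoint D (Cs i) (Cs j)) → (∀ i → ProperlyIntersects D U (Cs i)) →
    t ≤ outDegree D U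
  crossings≤outDegree U Cs disjoint crossing =
    disjoint-exits⇒≤outDegree U (λ i → walkArcs D (Cycle.walk (Cs i)))
      (λ i → cycle-exits {U} {Cs i} (crossing i))
      λ i j i≢j a a∈i a∈j → disjoint i j i≢j (tail a) (∈-map⁺ tail a∈i) (∈-map⁺ tail a∈j)

  module Chains {k : ℕ} {r s : Vertex D} (conn : SteinerRootedArcConnected D k r (_≡ s))
    {N : ℕ} (𝒞 : Fin N → Cycle D) (disjoint : ∀ i j → i ≢ j → VertexDisjoint D (𝒞 i) (𝒞 j)) where

    Tight : VSet D → Set
    Tight = TightCut D k r s

    crossings≤k : ∀ {B : Set} (f : B → Fin N) {U xs} → Tight U → AllPairs (_≢_ on f) xs →
      All (λ x → ProperlyIntersects D U (𝒞 (f x))) xs → length xs ≤ k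
    crossings≤k f {U} {xs} (_ , U-tight) distinct crossing = subst (length xs ≤_) U-tight
      (crossings≤outDegree U (𝒞 ∘ f ∘ lookup xs)
        (λ i j i≢j → disjoint _ _ (i≢j ∘ lookup-injective distinct i j))
        (λ i → All.lookup crossing (∈-lookup i)))

    -- A Boolean selects the inner (∩, ⊆, Inside) or the outer (∪, ⊇, Outside) version of each step.
    refine : Bool → VSet D → VSet D → VSet D
    refine true X W = X ∩ W
    refine false X W = X ∪ W

    Nested : Bool → VSet D → VSet D → Set
    Nested true X W = X ⊆ W
    Nested false X W = W ⊆ X

    refine-tight : ∀ d {X W} → Tight X → Tight W → Tight (refine d X W)
    refine-tight true X-tight W-tight = proj₁ (tight-∩-∪ conn refl X-tight W-tight)
    refine-tight false X-tight W-tight = proj₂ (tight-∩-∪ conn refl X-tight W-tight)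

    refine-crosses : ∀ d {X W C} → ProperlyIntersects D X C → Side d W C →
      ProperlyIntersects D (refine d X W) C
    refine-crosses true ((v , v∈C , v∈X) , (w , w∈C , w∉X)) inside =
      (v , v∈C , Equivalence.from T-∧ (v∈X , All.lookup inside v∈C)) , (w , w∈C , T-not-∧ˡ w∉X)
    refine-crosses false ((v , v∈C , v∈X) , (w , w∈C , w∉X)) outside =
      (v , v∈C , Equivalence.from T-∨ (inj₁ v∈X)) , (w , w∈C , T-not-∨ w∉X (All.lookup outside w∈C))

    refine-nested : ∀ d {X W} → Nested d (refine d X W) W
    refine-nested true = proj₂ ∘ Equivalence.to T-∧
    refine-nested false = Equivalence.from T-∨ ∘ inj₂

    nested-refine : ∀ e d {X W Z} → Nested e X Z → Nested e W Z → Nested e (refine d X W) Z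
    nested-refine true true X⊆Z _ = X⊆Z ∘ proj₁ ∘ Equivalence.to T-∧
    nested-refine true false X⊆Z W⊆Z = [ X⊆Z , W⊆Z ]′ ∘ Equivalence.to T-∨
    nested-refine false true Z⊆X Z⊆W v∈Z = Equivalence.from T-∧ (Z⊆X v∈Z , Z⊆W v∈Z)
    nested-refine false false Z⊆X _ = Equivalence.from T-∨ ∘ inj₁ ∘ Z⊆X

    record Entry : Set where
      field
        cycle   : Fin N
        cut     : VSet D
        side    : Bool
        tight   : Tight cut
        crosses : ProperlyIntersects D cut (𝒞 cycle)
    open Entry

    Placed : Entry → Fin N → VSet D → Set
    Placed e i X = Nested (side e) X (cut e) × Side (side e) (cut e) (𝒞 i)

    Follows : Entry → Entry → Set
    Follows a b = Placed b (cycle a) (cut a)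

    Crosses : Entry → Entry → Set
    Crosses a b = ProperlyIntersects D (cut a) (𝒞 (cycle b))

    Candidate : (Fin N → VSet D) → List Entry → Fin N → Set
    Candidate V chain i =
      Tight (V i) × ProperlyIntersects D (V i) (𝒞 i) × All (λ e → Placed e i (V i)) chain

    candidate-entry : ∀ {V chain} j → Bool → Candidate V chain j → Entry
    candidate-entry {V} j d (j-tight , j-crosses , _) =
      record { cycle = j ; cut = V j ; side = d ; tight = j-tight ; crosses = j-crosses }

    refine-candidate : ∀ d {V chain j x} (cj : Candidate V chain j) → Candidate V chain x →
      Side d (V j) (𝒞 x) → Candidate (λ y → refine d (V y) (V j)) (candidate-entry {V} j d cj ∷ chain) x
    refine-candidate d {V} {_} {j} {x} (j-tight , _ , j-placed) (x-tight , x-crosses , x-placed) x-side =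
      refine-tight d {V x} {V j} x-tight j-tight ,
      refine-crosses d {V x} {V j} x-crosses x-side ,
      (refine-nested d {V x} {V j} , x-side) ∷
        All.zipWith (λ {e} → refine-placed {e}) (x-placed , j-placed)
      where
      refine-placed : ∀ {e} → Placed e x (V x) × Placed e j (V j) → Placed e x (refine d (V x) (V j))
      refine-placed {e} ((x-nested , x-side′) , (j-nested , _)) =
        nested-refine (side e) d {V x} {V j} {cut e} x-nested j-nested , x-side′

    uncrossed : VSet D → List (Fin N) → List (Fin N)
    uncrossed W = filter (¬? ∘ crosses? W ∘ 𝒞)

    onSide : Bool → VSet D → List (Fin N) → List (Fin N)
    onSide d W F = filter (side? d W ∘ 𝒞) (uncrossed W F)

    onSide-unique : ∀ d W {F} → Unique F → Unique (onSide d W F)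
    onSide-unique d W = AllPairsₚ.filter⁺ (side? d W ∘ 𝒞) ∘ AllPairsₚ.filter⁺ (¬? ∘ crosses? W ∘ 𝒞)

    refine-candidates : ∀ d {V chain j} (cj : Candidate V chain j) {F} → All (Candidate V chain) F →
      All (Candidate (λ y → refine d (V y) (V j)) (candidate-entry {V} j d cj ∷ chain)) (onSide d (V j) F)
    refine-candidates d {V} {chain} {j} cj {F} candidates =
      All.zipWith (λ {x} → uncurry (refine-candidate d {V} {chain} {j} {x} cj))
        ( Allₚ.filter⁺ (side? d (V j) ∘ 𝒞) (Allₚ.filter⁺ (¬? ∘ crosses? (V j) ∘ 𝒞) candidates)
        , all-filter (side? d (V j) ∘ 𝒞) (uncrossed (V j) F))

    majority-side : ∀ {B} W F → Tight W → Unique F → B + B + k ≤ length F →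
      Σ Bool λ d → B ≤ length (onSide d W F)
    majority-side {B} W F W-tight unique large =
      [ (true ,_) , (false ,_) ]′ (half≤either (+-cancelʳ-≤ k _ _ (begin
        B + B + k
          ≤⟨ large ⟩
        length F
          ≤⟨ length-filter-⊎ crossed? (¬? ∘ crossed?) (All.universal (toSum ∘ crossed?) F) ⟩
        length (filter crossed? F) + length (uncrossed W F)
          ≤⟨ +-mono-≤ (crossings≤k id W-tight (AllPairsₚ.filter⁺ crossed? unique) (all-filter crossed? F))
                      (length-filter-⊎ (side? true W ∘ 𝒞) (side? false W ∘ 𝒞)
                        (All.map (λ {i} → inside-or-outside {W} {𝒞 i}) (all-filter (¬? ∘ crossed?) F))) ⟩
        k + (length (onSide true W F) + length (onSide false W F))
          ≡⟨ +-comm k _ ⟩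
        length (onSide true W F) + length (onSide false W F) + k ∎)))
      where
      open ≤-Reasoning
      crossed? : Decidable (λ i → ProperlyIntersects D W (𝒞 i))
      crossed? = crosses? W ∘ 𝒞

    -- A chain lists its most recently recorded entry first.
    grow : ∀ L F V chain → Unique F → All (Candidate V chain) F → AllPairs Follows chain →
      chainBound k L ≤ length F →
      Σ (List Entry) λ chain′ → AllPairs Follows chain′ × L + length chain ≤ length chain′
    grow zero _ _ chain _ _ follows _ = chain , follows , ≤-refl
    grow (suc L) [] _ _ _ _ _ ()
    grow (suc L) (j ∷ F) V chain (_ ∷ unique) (cj ∷ candidates) follows (s≤s large)
      with d , large′ ← majority-side (V j) F (proj₁ cj) unique large
      with chain′ , follows′ , long ←
             grow L (onSide d (V j) F) (λ y → refine d (V y) (V j)) (candidate-entry {V} j d cj ∷ chain)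
               (onSide-unique d (V j) unique) (refine-candidates d cj candidates)
               (proj₂ (proj₂ cj) ∷ follows) large′
      = chain′ , follows′ , subst (_≤ length chain′) (+-suc L (length chain)) long

    long-chain : ∀ L → (∀ i → Essential D k r s (𝒞 i)) → chainBound k L ≤ N →
      Σ (List Entry) λ chain → AllPairs Follows chain × L ≤ length chain
    long-chain L essential N≥
      with chain , follows , long ←
             grow L (allFin N) (proj₁ ∘ essential) [] (allFin⁺ N)
               (tabulate⁺ λ i → proj₁ (proj₂ (essential i)) , proj₂ (proj₂ (essential i)) , [])
               [] (subst (chainBound k L ≤_) (sym (length-tabulate id)) N≥)
      = chain , follows , subst (_≤ length chain) (+-identityʳ L) long

    follows⇒≢ : ∀ {a b} → Follows a b → cycle a ≢ cycle b
    follows⇒≢ {a} {b} (_ , a-side) eq = crosses⇒¬side (side b) {cut b} {𝒞 (cycle b)} (crosses b)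
      (subst (λ i → Side (side b) (cut b) (𝒞 i)) eq a-side)

    crossed-by? : ∀ a → Decidable (Crosses a)
    crossed-by? a b = crosses? (cut a) (𝒞 (cycle b))

    -- The fuel only makes the recursion, which is on a filtered tail, structural.
    sparsify : ∀ {R : Entry → Entry → Set} fuel xs → length xs ≤ fuel →
      AllPairs R xs → AllPairs (_≢_ on cycle) xs →
      Σ (List Entry) λ ys → ys Sublist.⊆ xs × AllPairs (λ a b → R a b × ¬ Crosses a b) ys ×
                            length xs ≤ k * length ys
    sparsify _ [] _ _ _ = [] , Sublist.[] , [] , z≤n
    sparsify (suc fuel) (x ∷ xs) (s≤s xs≤fuel) (Rx ∷ Rxs) (x≢ ∷ distinct)
      with ys , ys⊆kept , sparse , thin ←
             sparsify fuel (filter (¬? ∘ crossed-by? x) xs) (≤-trans (length-filter _ xs) xs≤fuel)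
               (AllPairsₚ.filter⁺ _ Rxs) (AllPairsₚ.filter⁺ _ distinct)
      = x ∷ ys ,
        refl Sublist.∷ Sublist.⊆-trans ys⊆kept (filter-⊆ (¬? ∘ crossed-by? x) xs) ,
        All-resp-⊆ ys⊆kept (All.zip (Allₚ.filter⁺ _ Rx , all-filter (¬? ∘ crossed-by? x) xs)) ∷ sparse ,
        thin-∷ {ys} thin
      where
      open ≤-Reasoning
      crossed : List Entry
      crossed = filter (crossed-by? x) xs

      thin-∷ : ∀ {ys} → length (filter (¬? ∘ crossed-by? x) xs) ≤ k * length ys →
        suc (length xs) ≤ k * suc (length ys)
      thin-∷ {ys} thin = begin
        suc (length xs)
          ≤⟨ s≤s (length-filter-⊎ (crossed-by? x) (¬? ∘ crossed-by? x)
                   (All.universal (toSum ∘ crossed-by? x) xs)) ⟩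
        length (x ∷ crossed) + length (filter (¬? ∘ crossed-by? x) xs)
          ≤⟨ +-mono-≤ (crossings≤k cycle {cut x} {x ∷ crossed} (tight x)
                         (Allₚ.filter⁺ _ x≢ ∷ AllPairsₚ.filter⁺ _ distinct)
                         (crosses x ∷ all-filter (crossed-by? x) xs))
                      thin ⟩
        k + k * length ys
          ≡⟨ sym (*-suc k (length ys)) ⟩
        k * suc (length ys) ∎

    Precedes : Entry → Entry → Set
    Precedes a b = Inside (cut b) (𝒞 (cycle a)) × Outside (cut a) (𝒞 (cycle b))

    -- On the inner side the chain order is the s-order; on the outer side it is reversed.
    Oriented : Bool → Entry → Entry → Set
    Oriented true = Precedes
    Oriented false = flip Precedes

    follows⇒oriented : ∀ {a b} → Follows a b → ¬ Crosses a b → Oriented (side b) a b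
    follows⇒oriented {a} {b = record { cycle = j ; side = true ; crosses = (_ , (v , v∈b , v∉b)) }}
                     (a⊆b , a-inside) ¬crosses =
      a-inside , outside-of-¬crosses {cut a} {𝒞 j} ¬crosses (v , v∈b , T-not-contra a⊆b v∉b)
    follows⇒oriented {a} {b = record { cycle = j ; side = false ; crosses = ((v , v∈b , v∈b′) , _) }}
                     (b⊆a , a-outside) ¬crosses =
      inside-of-¬crosses {cut a} {𝒞 j} ¬crosses (v , v∈b , b⊆a v∈b′) , a-outside

    OrientedChain : ℕ → Set
    OrientedChain q = Σ Bool λ d → Σ (List Entry) λ zs → AllPairs (Oriented d) zs × q ≤ length zs

    majority-orientation : ∀ {q} ys → AllPairs (λ a b → Follows a b × ¬ Crosses a b) ys →
      q + q ≤ length ys → OrientedChain q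
    majority-orientation {q} ys sparse long =
      [ oriented-part true , oriented-part false ]′ (half≤either (≤-trans long
        (length-filter-⊎ (has-side true) (has-side false) (All.universal (true-or-false ∘ side) ys))))
      where
      has-side : ∀ d → Decidable (λ e → side e ≡ d)
      has-side d e = side e Bool.≟ d

      orient : ∀ {d a b} → (Follows a b × ¬ Crosses a b) × side b ≡ d → Oriented d a b
      orient {a = a} {b} ((follows , ¬crosses) , refl) = follows⇒oriented {a} {b} follows ¬crosses

      oriented-part : ∀ d → q ≤ length (filter (has-side d) ys) → OrientedChain q
      oriented-part d q≤ =
        d , filter (has-side d) ys ,
        AllPairs.map orient
          (AllPairs-×-All (AllPairsₚ.filter⁺ (has-side d) sparse) (all-filter (has-side d) ys)) ,
        q≤

    precedes⇒ordered : ∀ q zs → AllPairs Precedes zs → q ≤ length zs →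
      Σ (Fin q → Fin N) λ g → Ordered D k r s q (λ i → 𝒞 (g i))
    precedes⇒ordered q zs precedes q≤ =
      cycle ∘ e , cut ∘ e , tight ∘ e ,
      (λ i j i<j v v∈Ci → All.lookup (proj₁ (e-precedes i<j)) v∈Ci) ,
      (λ i j j<i v v∈Ci → All.lookup (proj₂ (e-precedes j<i)) v∈Ci) ,
      crosses ∘ e
      where
      e : Fin q → Entry
      e i = lookup zs (inject≤ i q≤)

      e-precedes : ∀ {i j} → i Fin.< j → Precedes (e i) (e j)
      e-precedes {i} {j} i<j =
        AllPairs-lookup precedes (subst₂ _<_ (sym (toℕ-inject≤ i q≤)) (sym (toℕ-inject≤ j q≤)) i<j)

    oriented⇒ordered : ∀ {q} → OrientedChain q →
      Σ (Fin q → Fin N) λ g → Ordered D k r s q (λ i → 𝒞 (g i))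
    oriented⇒ordered {q} (true , zs , oriented , q≤) = precedes⇒ordered q zs oriented q≤
    oriented⇒ordered {q} (false , zs , oriented , q≤) =
      precedes⇒ordered q (reverse zs) (AllPairs-reverse {R = Precedes} oriented)
        (subst (q ≤_) (sym (length-reverse zs)) q≤)

    ordered-subfamily : ∀ q → k > 0 → (∀ i → Essential D k r s (𝒞 i)) →
      chainBound k (k * (q + q)) ≤ N →
      Σ (Fin q → Fin N) λ g → Ordered D k r s q (λ i → 𝒞 (g i))
    ordered-subfamily q k>0 essential N≥
      with chain , follows , long ← long-chain (k * (q + q)) essential N≥
      with ys , _ , sparse , thin ←
             sparsify (length chain) chain ≤-refl follows (AllPairs.map (λ {a} {b} → follows⇒≢ {a} {b}) follows)
      = oriented⇒ordered
          (majority-orientation ys sparse (*-cancelˡ-≤ k {{>-nonZero k>0}} (≤-trans long thin)))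

proposition2p3 : (q k : ℕ) → q > 0 → k > 0 →
    Σ ℕ λ f →
      (D : Digraph) (r s : Vertex D) →
      SteinerRootedArcConnected D k r (λ v → v ≡ s) →
      (N : ℕ) (𝒞 : Fin N → Cycle D) →
      (∀ i j → i ≢ j → VertexDisjoint D (𝒞 i) (𝒞 j)) →
      (∀ i → Essential D k r s (𝒞 i)) →
      f ≤ N →
      Σ (Fin q → Fin N) λ g → Ordered D k r s q (λ i → 𝒞 (g i))
proposition2p3 q k _ k>0 = chainBound k (k * (q + q)) , λ D r s conn N 𝒞 disjoint essential →
  Chains.ordered-subfamily D conn 𝒞 disjoint q k>0 essential
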